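{- Let $q$ be a prime power, $s\ge2$, and $n=q^{s-1}$. The extended weight enumerator of the first order $q$-ary Reed–Muller code $\mathcal{RM}_q(1,s-1)$ is \[ W_{\mathcal{RM}_q(1,s-1)}(X,Y,T)=\sum_{r=1}^s\left(\prod_{j=0}^{r-1}(T-q^j)\right)\left[{s-1\atop r-1}\right]_q Y^n+\sum_{r=0}^{s-1}\left(\prod_{j=0}^{r-1}(T-q^j)\right)q^r\left[{s-1\atop r}\right]_q X^{q^{s-1-r}}Y^{q^{s-1}-q^{s-1-r}}. \]
   Context: The first order $q$-ary Reed–Muller code $\mathcal{RM}_q(1,s-1)$ is the linear $[q^{s-1},s]$ code over $\mathbb{F}_q$ with generator matrix whose columns are the vectors $(1,v)^T$, $v$ ranging over $\mathbb{F}_q^{s-1}$. For a linear code $C$ of length $n$ over $\mathbb{F}_q$ and $m\ge1$, the extension code $C\otimes\mathbb{F}_{q^m}$ is the $\mathbb{F}_{q^m}$-linear span of $C$ in $\mathbb{F}_{q^m}^n$. The extended weight enumerator is $W_C(X,Y,T)=\sum_{w=0}^n A_w(T)X^{n-w}Y^w$, where $A_w(T)$ is the integer polynomial such that $A_w(q^m)$ is the number of words of weight $w$ in $C\otimes\mathbb{F}_{q^m}$ for every $m\ge1$. The Gaussian binomial $\left[{a\atop b}\right]_q$ is the number of $b$-dimensional subspaces of $\mathbb{F}_q^a$. Empty products equal $1$. -}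

module Defs where

open import Level using (Level; _⊔_) renaming (suc to lsuc)
open import Data.Nat as ℕ using (ℕ; zero; suc; _^_; _∸_)
open import Data.Nat.Primality using (Prime)
open import Data.Integer as ℤ using (ℤ; +_)
open import Data.Fin as Fin using (Fin)
open import Data.Vec as Vec using (Vec; []; _∷_)
open import Data.List as List using (List; []; _∷_; _++_)
open import Data.Bool using (true)
open import Data.Product using (Σ; ∃; _×_; _,_)
open import Relation.Nullary using (¬_; Dec; yes; no; does)
open import Relation.Binary using (Decidable)
open import Relation.Binary.PropositionalEquality as ≡ using (_≡_)
open import Function.Bundles using (Inverse)
open import Algebra.Bundles using (CommutativeRing)
open import Algebra.Morphism.Structures using (module RingMorphisms)

private variable c ℓ c′ ℓ′ : Level

IsPrimePower : ℕ → Set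
IsPrimePower q = ∃ λ p → ∃ λ k → Prime p × 1 ℕ.≤ k × q ≡ p ^ k

record IsField (R : CommutativeRing c ℓ) : Set (c ⊔ ℓ) where
  open CommutativeRing R
  field
    1≉0 : ¬ (1# ≈ 0#)
    inv : ∀ x → ¬ (x ≈ 0#) → ∃ λ y → (x * y) ≈ 1#

record FiniteField (c ℓ : Level) (size : ℕ) : Set (lsuc (c ⊔ ℓ)) where
  field
    commRing : CommutativeRing c ℓ
    isField  : IsField commRing
    enum    : Inverse (CommutativeRing.setoid commRing) (≡.setoid (Fin size))
  open CommutativeRing commRing public

  _≟_ : Decidable _≈_
  x ≟ y with Inverse.to enum x Fin.≟ Inverse.to enum y
  ... | yes p = yes (trans (sym (Inverse.inverseʳ enum {x} (≡.sym p)))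
                           (Inverse.inverseʳ enum {y} ≡.refl))
  ... | no ¬p = no (λ x≈y → ¬p (Inverse.to-cong enum x≈y))

IsFieldHom : ∀ {q Q} (F : FiniteField c ℓ q) (K : FiniteField c′ ℓ′ Q) →
             (FiniteField.Carrier F → FiniteField.Carrier K) → Set _
IsFieldHom F K ι = RingMorphisms.IsRingHomomorphism
  (FiniteField.rawRing F) (FiniteField.rawRing K) ι

-- The first order Reed–Muller code RM_q(1, k) (here k = s - 1) and its
-- extension to K = F_{q^m}.  Coordinates are indexed by v ∈ F_q^k, with
-- F_q enumerated by the bijection `enum`, i.e. by Vec (Fin q) k.

allVecs : (q k : ℕ) → List (Vec (Fin q) k)
allVecs q zero    = [] ∷ []
allVecs q (suc k) = List.concatMap (λ a → List.map (a ∷_) (allVecs q k)) (List.allFin q)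

module RM {q Q : ℕ} (F : FiniteField c ℓ q) (K : FiniteField c′ ℓ′ Q)
          (ι : FiniteField.Carrier F → FiniteField.Carrier K) (k : ℕ) where
  open FiniteField K

  Coord : Set
  Coord = Vec (Fin q) k

  Word : Set c′
  Word = Coord → Carrier

  el : Fin q → Carrier
  el a = ι (Inverse.from (FiniteField.enum F) a)

  dot : ∀ {j} → (Fin j → Carrier) → Vec (Fin q) j → Carrier
  dot x []      = 0#
  dot x (a ∷ u) = (x Fin.zero * el a) + dot (λ i → x (Fin.suc i)) u

  -- the codeword x·G, G the generator matrix with columns (1, v)ᵀ
  encode : (Fin (suc k) → Carrier) → Word
  encode x u = x Fin.zero + dot (λ i → x (Fin.suc i)) u

  -- membership in the extension code RM_q(1,k) ⊗ K (the K-span of the rows of G)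
  InCode : Word → Set (c′ ⊔ ℓ′)
  InCode w = ∃ λ (x : Fin (suc k) → Carrier) → ∀ u → w u ≈ encode x u

  weight : Word → ℕ
  weight w = List.length (List.filter (λ u → Relation.Nullary.¬? (w u ≟ 0#)) (allVecs q k))

  _≋_ : Word → Word → Set ℓ′
  w ≋ w′ = ∀ u → w u ≈ w′ u

  CountIs : (Word → Set (c′ ⊔ ℓ′)) → ℕ → Set (c′ ⊔ ℓ′)
  CountIs P N = Σ (Fin N → Word) λ ws →
      (∀ i → P (ws i))
    × (∀ i j → ws i ≋ ws j → i ≡ j)
    × (∀ w → P w → ∃ λ i → w ≋ ws i)

  NumWordsOfWeight : ℕ → ℤ → Set (c′ ⊔ ℓ′)
  NumWordsOfWeight b z = ∃ λ N → z ≡ + N × CountIs (λ w → InCode w × weight w ≡ b) N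

gauss : ℕ → ℕ → ℕ → ℕ
gauss q a       zero    = 1
gauss q zero    (suc b) = 0
gauss q (suc a) (suc b) = gauss q a b ℕ.+ q ^ suc b ℕ.* gauss q a (suc b)

prodT : ℤ → ℕ → ℕ → ℤ
prodT T q zero    = ℤ.+ 1
prodT T q (suc r) = prodT T q r ℤ.* (T ℤ.- + (q ^ r))

-- The right-hand side as a polynomial in X, Y (coefficients depending on T):
-- a list of monomials (coefficient, exponent of X, exponent of Y).

Monomial : Set
Monomial = ℤ × ℕ × ℕ

rmFormula : (q s : ℕ) → ℤ → List Monomial
rmFormula q s T =
     List.map (λ r → (prodT T q r ℤ.* + gauss q (s ∸ 1) (r ∸ 1) , 0 , q ^ (s ∸ 1)))
              (List.map suc (List.upTo s))
  ++ List.map (λ r → ( prodT T q r ℤ.* + (q ^ r ℕ.* gauss q (s ∸ 1) r)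
                     , q ^ (s ∸ 1 ∸ r)
                     , q ^ (s ∸ 1) ∸ q ^ (s ∸ 1 ∸ r)))
              (List.upTo s)

coeffXY : ℕ → ℕ → List Monomial → ℤ
coeffXY a b []                  = + 0
coeffXY a b ((z , i , j) ∷ ms) with does (i ℕ.≟ a) | does (j ℕ.≟ b)
... | true | true = z ℤ.+ coeffXY a b ms
... | _    | _    = coeffXY a b ms

module Submission where

-- A word of RM_q(1,k) ⊗ K, K = F_Q, is u ↦ y + x·u (u ∈ F_q^k)
-- for a unique (y, x) ∈ K × K^k.  Its zeros are the solutions of x·u = −y, and
-- the solution set of x·u = t is empty unless t lies in the F_q-span of the
-- entries of x, in which case it has q^(k − rank x) elements (solutions≡), where
-- rank x is the F_q-dimension of that span; the span has q^(rank x) elements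
-- (spanSize).  Hence for fixed x of rank r, q^r choices of y give weight
-- n − q^(k−r) and Q − q^r give weight n (wordsOfRank), and the number of
-- x ∈ K^k of rank r is [k r]_q ∏_{i<r}(Q − q^i) (rankCount≡, by the q-Pascal
-- recursion).  Summing over r gives the number of words of each weight
-- (weightCount), and a direct coefficient extraction shows that the stated
-- polynomial has exactly these coefficients at T = q^m (rmFormula-coeff).

open import Defs
open import Level using (Level)
open import Data.Bool using (Bool; true; false; not; if_then_else_)
open import Data.Bool.Properties using (if-float)
open import Data.Nat as ℕ using (ℕ; zero; suc; _∸_; _^_; _≤_; _<_; _≡ᵇ_; s≤s; z≤n; NonZero)
import Data.Nat.Properties as ℕₚ
open import Data.Nat.Tactic.RingSolver using (solve-∀)
open import Data.Integer as ℤ using (ℤ)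
import Data.Integer.Properties as ℤₚ
open import Data.Fin as Fin using (Fin)
import Data.Fin.Properties as Finₚ
open import Data.Vec using (Vec; []; _∷_)
open import Data.Vec.Functional using (Vector; head; tail) renaming (_∷_ to _◂_)
open import Data.List using (List; []; _∷_; _++_; map; length; tabulate; filter; concatMap; upTo; applyUpTo; allFin; cartesianProductWith; lookup)
open import Data.List.Properties using (length-tabulate; map-∘)
import Data.List.Relation.Unary.All as All
import Data.List.Relation.Unary.All.Properties as Allₚ
import Data.List.Relation.Unary.Any as Any
import Data.List.Relation.Unary.Any.Properties as Anyₚ
open import Data.List.Relation.Unary.AllPairs using ([]; _∷_)
open import Data.List.Relation.Unary.Unique.Setoid using (Unique)
import Data.List.Relation.Unary.Unique.Setoid.Properties as Uniqueₚ
import Data.List.Membership.Setoid as Membership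
import Data.List.Membership.Setoid.Properties as Memberₚ
open import Data.List.Membership.Propositional.Properties using () renaming (∈-lookup to ∈ₚ-lookup)
open import Data.Product using (Σ; ∃; _×_; _,_; proj₁; proj₂)
open import Data.Empty using (⊥-elim)
open import Relation.Nullary using (¬_; ¬?; Dec; yes; no; does)
open import Relation.Nullary.Decidable using (dec-true; dec-false; does-⇔)
open import Relation.Unary using (Pred; Decidable)
open import Relation.Binary.Bundles using (Setoid)
open import Relation.Binary.PropositionalEquality as ≡ using (_≡_; _≢_)
import Relation.Binary.Reasoning.Setoid
open import Function using (_∘_; id)
open import Function.Bundles using (Inverse; Equivalence; _⇔_; mk⇔)
open import Algebra.Morphism.Structures using (module RingMorphisms)
import Algebra.Properties.Ring

private variable a b : Level

-- Finite sums of natural numbers over lists and ranges.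
module FiniteSums where
  open import Data.Nat using (_+_; _*_)
  open ℕₚ
  open ≡ using (refl; sym; trans; cong; cong₂; module ≡-Reasoning)

  𝟙 : Bool → ℕ
  𝟙 true  = 1
  𝟙 false = 0

  ∑ : {A : Set a} → (A → ℕ) → List A → ℕ
  ∑ f []       = 0
  ∑ f (x ∷ xs) = f x + ∑ f xs

  ∑< : ℕ → (ℕ → ℕ) → ℕ
  ∑< zero    F = 0
  ∑< (suc N) F = F 0 + ∑< N (F ∘ suc)

  -- `does (m ≟ n)` computes to `m ≡ᵇ n`; these let proofs rewrite it.
  ≡ᵇ-true : ∀ {m n} → m ≡ n → (m ≡ᵇ n) ≡ true
  ≡ᵇ-true {m} {n} = dec-true (m ℕ.≟ n)

  ≡ᵇ-false : ∀ {m n} → m ≢ n → (m ≡ᵇ n) ≡ false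
  ≡ᵇ-false {m} {n} = dec-false (m ℕ.≟ n)

  𝟙-≡ᵇ-subst : ∀ (f : ℕ → ℕ) ρ r → f ρ * 𝟙 (ρ ≡ᵇ r) ≡ 𝟙 (ρ ≡ᵇ r) * f r
  𝟙-≡ᵇ-subst f ρ r with ρ ℕ.≟ r
  ... | yes refl rewrite ≡ᵇ-true {ρ} refl = *-comm (f ρ) 1
  ... | no  ρ≢r  rewrite ≡ᵇ-false ρ≢r     = *-zeroʳ (f ρ)

  module _ {A : Set a} where

    ∑-cong : {f g : A → ℕ} → (∀ x → f x ≡ g x) → ∀ xs → ∑ f xs ≡ ∑ g xs
    ∑-cong f≗g []       = refl
    ∑-cong f≗g (x ∷ xs) = cong₂ _+_ (f≗g x) (∑-cong f≗g xs)

    ∑-++ : ∀ (f : A → ℕ) xs ys → ∑ f (xs ++ ys) ≡ ∑ f xs + ∑ f ys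
    ∑-++ f []       ys = refl
    ∑-++ f (x ∷ xs) ys = trans (cong (f x +_) (∑-++ f xs ys)) (sym (+-assoc (f x) _ _))

    ∑-+ : ∀ (f g : A → ℕ) xs → ∑ (λ x → f x + g x) xs ≡ ∑ f xs + ∑ g xs
    ∑-+ f g []       = refl
    ∑-+ f g (x ∷ xs) = trans (cong (f x + g x +_) (∑-+ f g xs)) (+-+-comm (f x) (g x) _ _)
      where
      +-+-comm : ∀ m n o p → m + n + (o + p) ≡ m + o + (n + p)
      +-+-comm = solve-∀

    ∑-*ʳ : ∀ c (f : A → ℕ) xs → ∑ (λ x → f x * c) xs ≡ ∑ f xs * c
    ∑-*ʳ c f []       = refl
    ∑-*ʳ c f (x ∷ xs) = trans (cong (f x * c +_) (∑-*ʳ c f xs)) (sym (*-distribʳ-+ c (f x) _))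

    ∑-const : ∀ c (xs : List A) → ∑ (λ _ → c) xs ≡ length xs * c
    ∑-const c []       = refl
    ∑-const c (x ∷ xs) = cong (c +_) (∑-const c xs)

    ∑-zero : {f : A → ℕ} → (∀ x → f x ≡ 0) → ∀ xs → ∑ f xs ≡ 0
    ∑-zero f≗0 xs = trans (∑-cong f≗0 xs) (trans (∑-const 0 xs) (*-zeroʳ (length xs)))

    count+count-not : ∀ (p : A → Bool) xs →
      ∑ (λ x → 𝟙 (p x)) xs + ∑ (λ x → 𝟙 (not (p x))) xs ≡ length xs
    count+count-not p []       = refl
    count+count-not p (x ∷ xs) with p x
    ... | true  = cong suc (count+count-not p xs)
    ... | false = trans (+-suc _ _) (cong suc (count+count-not p xs))

    count-not : ∀ (p : A → Bool) xs →
      ∑ (λ x → 𝟙 (not (p x))) xs ≡ length xs ∸ ∑ (λ x → 𝟙 (p x)) xs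
    count-not p xs = sym (trans (cong (_∸ ∑ (λ x → 𝟙 (p x)) xs) (sym (count+count-not p xs)))
                                (m+n∸m≡n (∑ (λ x → 𝟙 (p x)) xs) _))

    ∑-if : ∀ (p : A → Bool) u v xs →
      ∑ (λ x → if p x then u else v) xs ≡
        ∑ (λ x → 𝟙 (p x)) xs * u + (length xs ∸ ∑ (λ x → 𝟙 (p x)) xs) * v
    ∑-if p u v xs = begin
        ∑ (λ x → if p x then u else v) xs
      ≡⟨ ∑-cong split xs ⟩
        ∑ (λ x → 𝟙 (p x) * u + 𝟙 (not (p x)) * v) xs
      ≡⟨ ∑-+ _ _ xs ⟩
        ∑ (λ x → 𝟙 (p x) * u) xs + ∑ (λ x → 𝟙 (not (p x)) * v) xs
      ≡⟨ cong₂ _+_ (∑-*ʳ u _ xs) (∑-*ʳ v _ xs) ⟩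
        ∑ (λ x → 𝟙 (p x)) xs * u + ∑ (λ x → 𝟙 (not (p x))) xs * v
      ≡⟨ cong (λ c → ∑ (λ x → 𝟙 (p x)) xs * u + c * v) (count-not p xs) ⟩
        ∑ (λ x → 𝟙 (p x)) xs * u + (length xs ∸ ∑ (λ x → 𝟙 (p x)) xs) * v ∎
      where
      open ≡-Reasoning
      split : ∀ x → (if p x then u else v) ≡ 𝟙 (p x) * u + 𝟙 (not (p x)) * v
      split x with p x
      ... | true  = sym (trans (+-identityʳ _) (+-identityʳ u))
      ... | false = sym (+-identityʳ v)

    length-filter : ∀ {P : Pred A b} (P? : Decidable P) xs →
      length (filter P? xs) ≡ ∑ (λ x → 𝟙 (does (P? x))) xs
    length-filter P? []       = refl
    length-filter P? (x ∷ xs) with does (P? x)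
    ... | true  = cong suc (length-filter P? xs)
    ... | false = length-filter P? xs

    ∑-tabulate-none : ∀ {n} {P : Pred A b} (P? : Decidable P) (f : Fin n → A) →
      (∀ i → ¬ P (f i)) → ∑ (λ x → 𝟙 (does (P? x))) (tabulate f) ≡ 0
    ∑-tabulate-none {n = zero}  P? f ¬P = refl
    ∑-tabulate-none {n = suc n} P? f ¬P rewrite dec-false (P? (f Fin.zero)) (¬P Fin.zero) =
      ∑-tabulate-none P? (f ∘ Fin.suc) (¬P ∘ Fin.suc)

    ∑-tabulate-unique : ∀ {n} {P : Pred A b} (P? : Decidable P) (f : Fin n → A) c →
      P (f c) → (∀ i → P (f i) → i ≡ c) → ∑ (λ x → 𝟙 (does (P? x))) (tabulate f) ≡ 1
    ∑-tabulate-unique P? f Fin.zero Pc only rewrite dec-true (P? (f Fin.zero)) Pc =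
      cong suc (∑-tabulate-none P? (f ∘ Fin.suc) (λ i Pi → Finₚ.0≢1+n (sym (only (Fin.suc i) Pi))))
    ∑-tabulate-unique P? f (Fin.suc c) Pc only
      rewrite dec-false (P? (f Fin.zero)) (λ P0 → Finₚ.0≢1+n (only Fin.zero P0)) =
      ∑-tabulate-unique P? (f ∘ Fin.suc) c Pc (λ i Pi → Finₚ.suc-injective (only (Fin.suc i) Pi))

  module _ {A : Set a} {B : Set b} where

    ∑-map : ∀ (f : B → ℕ) (g : A → B) xs → ∑ f (map g xs) ≡ ∑ (f ∘ g) xs
    ∑-map f g []       = refl
    ∑-map f g (x ∷ xs) = cong (f (g x) +_) (∑-map f g xs)

    ∑-concatMap : ∀ (f : B → ℕ) (g : A → List B) xs →
      ∑ f (concatMap g xs) ≡ ∑ (λ x → ∑ f (g x)) xs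
    ∑-concatMap f g []       = refl
    ∑-concatMap f g (x ∷ xs) =
      trans (∑-++ f (g x) (concatMap g xs)) (cong (∑ f (g x) +_) (∑-concatMap f g xs))

    ∑-swap : ∀ (f : A → B → ℕ) xs ys →
      ∑ (λ x → ∑ (f x) ys) xs ≡ ∑ (λ y → ∑ (λ x → f x y) xs) ys
    ∑-swap f []       ys = sym (∑-zero (λ _ → refl) ys)
    ∑-swap f (x ∷ xs) ys = trans (cong (∑ (f x) ys +_) (∑-swap f xs ys))
                                 (sym (∑-+ (f x) (λ y → ∑ (λ x′ → f x′ y) xs) ys))

  ∑-cartesianProductWith : ∀ {c} {A : Set a} {B : Set b} {C : Set c}
    (f : C → ℕ) (g : A → B → C) xs ys →
    ∑ f (cartesianProductWith g xs ys) ≡ ∑ (λ x → ∑ (f ∘ g x) ys) xs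
  ∑-cartesianProductWith f g []       ys = refl
  ∑-cartesianProductWith f g (x ∷ xs) ys =
    trans (∑-++ f (map (g x) ys) _)
          (cong₂ _+_ (∑-map f (g x) ys) (∑-cartesianProductWith f g xs ys))

  ∑-applyUpTo : ∀ (F g : ℕ → ℕ) n → ∑ F (applyUpTo g n) ≡ ∑< n (F ∘ g)
  ∑-applyUpTo F g zero    = refl
  ∑-applyUpTo F g (suc n) = cong (F (g 0) +_) (∑-applyUpTo F (g ∘ suc) n)

  ∑-upTo : ∀ (F : ℕ → ℕ) n → ∑ F (upTo n) ≡ ∑< n F
  ∑-upTo F = ∑-applyUpTo F id

  ∑<-cong : ∀ {F G : ℕ → ℕ} N → (∀ r → F r ≡ G r) → ∑< N F ≡ ∑< N G
  ∑<-cong zero    F≗G = refl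
  ∑<-cong (suc N) F≗G = cong₂ _+_ (F≗G 0) (∑<-cong N (F≗G ∘ suc))

  ∑<-delta : ∀ (F : ℕ → ℕ) {N} i → i < N → ∑< N (λ r → 𝟙 (i ≡ᵇ r) * F r) ≡ F i
  ∑<-delta F {suc N} zero    _ = trans (cong (F 0 + 0 +_) (∑<-zero N)) (trans (+-identityʳ _) (+-identityʳ _))
    where
    ∑<-zero : ∀ n → ∑< n (λ r → 𝟙 (0 ≡ᵇ suc r) * F (suc r)) ≡ 0
    ∑<-zero zero    = refl
    ∑<-zero (suc n) = ∑<-zero n
  ∑<-delta F {suc N} (suc i) (s≤s i<N) = ∑<-delta (F ∘ suc) i i<N

  ∑-group : ∀ {A : Set a} (stat : A → ℕ) (F : ℕ → ℕ) N → (∀ x → stat x < N) → ∀ xs →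
    ∑ (F ∘ stat) xs ≡ ∑< N (λ r → ∑ (λ x → 𝟙 (stat x ≡ᵇ r)) xs * F r)
  ∑-group stat F N bounded xs = begin
      ∑ (F ∘ stat) xs
    ≡⟨ ∑-cong (λ x → sym (trans (∑-upTo _ N) (∑<-delta F (stat x) (bounded x)))) xs ⟩
      ∑ (λ x → ∑ (λ r → 𝟙 (stat x ≡ᵇ r) * F r) (upTo N)) xs
    ≡⟨ ∑-swap (λ x r → 𝟙 (stat x ≡ᵇ r) * F r) xs (upTo N) ⟩
      ∑ (λ r → ∑ (λ x → 𝟙 (stat x ≡ᵇ r) * F r) xs) (upTo N)
    ≡⟨ ∑-upTo _ N ⟩
      ∑< N (λ r → ∑ (λ x → 𝟙 (stat x ≡ᵇ r) * F r) xs)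
    ≡⟨ ∑<-cong N (λ r → ∑-*ʳ (F r) (λ x → 𝟙 (stat x ≡ᵇ r)) xs) ⟩
      ∑< N (λ r → ∑ (λ x → 𝟙 (stat x ≡ᵇ r)) xs * F r) ∎
    where open ≡-Reasoning

open FiniteSums

-- Duplicate-free listings of elements and tuples of a setoid.
module Listing {ℓ} (S : Setoid a ℓ) where
  open Setoid S using (_≈_) renaming (Carrier to A; refl to ≈-refl; sym to ≈-sym)
  open import Data.Vec.Functional.Relation.Binary.Equality.Setoid S public using (_≋_; ≋-setoid)
  open Membership S using (_∈_)

  lookup-injective : ∀ {xs} → Unique S xs → ∀ i j → lookup xs i ≈ lookup xs j → i ≡ j
  lookup-injective (_   ∷ _) Fin.zero    Fin.zero    _ = ≡.refl
  lookup-injective (x≉ ∷ _) Fin.zero    (Fin.suc j) x≈ = ⊥-elim (All.lookup x≉ (∈ₚ-lookup j) x≈)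
  lookup-injective (x≉ ∷ _) (Fin.suc i) Fin.zero    ≈x = ⊥-elim (All.lookup x≉ (∈ₚ-lookup i) (≈-sym ≈x))
  lookup-injective (_   ∷ u) (Fin.suc i) (Fin.suc j) eq = ≡.cong Fin.suc (lookup-injective u i j eq)

  tuples : List A → (j : ℕ) → List (Vector A j)
  tuples els zero    = (λ ()) ∷ []
  tuples els (suc j) = cartesianProductWith _◂_ els (tuples els j)

  _∈ᵗ_ : ∀ {j} → Vector A j → List (Vector A j) → Set _
  _∈ᵗ_ {j} = Membership._∈_ (≋-setoid j)

  tuples-unique : ∀ {els} → Unique S els → ∀ j → Unique (≋-setoid j) (tuples els j)
  tuples-unique els! zero    = All.[] ∷ []
  tuples-unique els! (suc j) =
    Uniqueₚ.cartesianProductWith⁺ S (≋-setoid j) (≋-setoid (suc j)) _◂_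
      (λ y◂x≋y′◂x′ → y◂x≋y′◂x′ Fin.zero , y◂x≋y′◂x′ ∘ Fin.suc) els! (tuples-unique els! j)

  tuples-complete : ∀ {els} → (∀ y → y ∈ els) → ∀ j x → x ∈ᵗ tuples els j
  tuples-complete complete zero    x = Any.here (λ ())
  tuples-complete complete (suc j) x =
    Memberₚ.∈-resp-≈ (≋-setoid (suc j)) head◂tail≋x
      (Memberₚ.∈-cartesianProductWith⁺ S (≋-setoid j) (≋-setoid (suc j)) ◂-cong
        (complete (head x)) (tuples-complete complete j (tail x)))
    where
    head◂tail≋x : head x ◂ tail x ≋ x
    head◂tail≋x Fin.zero    = ≈-refl
    head◂tail≋x (Fin.suc i) = ≈-refl
    ◂-cong : ∀ {y y′} {v v′ : Vector A j} → y ≈ y′ → v ≋ v′ → y ◂ v ≋ y′ ◂ v′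
    ◂-cong y≈y′ v≋v′ Fin.zero    = y≈y′
    ◂-cong y≈y′ v≋v′ (Fin.suc i) = v≋v′ i

  ∑-tuples-suc : ∀ {j} (f : Vector A (suc j) → ℕ) els →
    ∑ f (tuples els (suc j)) ≡ ∑ (λ x → ∑ (λ y → f (y ◂ x)) els) (tuples els j)
  ∑-tuples-suc {j} f els =
    ≡.trans (∑-cartesianProductWith f _◂_ els _) (∑-swap (λ y x → f (y ◂ x)) els (tuples els j))

-- Monomials of the right-hand side and their coefficients.
module Formula where
  open import Data.Nat using (_+_; _*_)
  open ℕₚ
  open ≡ using (refl; sym; trans; cong; cong₂; module ≡-Reasoning)
  open import Data.Integer using (+_)

  prodℕ : ℕ → ℕ → ℕ → ℕ
  prodℕ q Q zero    = 1
  prodℕ q Q (suc r) = prodℕ q Q r * (Q ∸ q ^ r)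

  -- At T = q^m the integer product ∏_{i<r} (T − q^i) has no negative factor before
  -- it hits the factor q^m − q^m = 0, so it agrees with its ℕ-version.
  module _ (q m : ℕ) .{{_ : NonZero q}} where

    prodℕ-vanishes : ∀ r → m < r → prodℕ q (q ^ m) r ≡ 0
    prodℕ-vanishes (suc r) (s≤s m≤r) with m ℕ.≟ r
    ... | yes refl = trans (cong (prodℕ q (q ^ r) r *_) (n∸n≡0 (q ^ r))) (*-zeroʳ (prodℕ q (q ^ r) r))
    ... | no m≢r   = cong (_* (q ^ m ∸ q ^ r)) (prodℕ-vanishes r (≤∧≢⇒< m≤r m≢r))

    prodT-vanishes : ∀ r → m < r → prodT (+ (q ^ m)) q r ≡ + 0
    prodT-vanishes (suc r) (s≤s m≤r) with m ℕ.≟ r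
    ... | yes refl = trans (cong (prodT (+ (q ^ r)) q r ℤ.*_) (ℤₚ.+-inverseʳ (+ (q ^ r))))
                           (ℤₚ.*-zeroʳ (prodT (+ (q ^ r)) q r))
    ... | no m≢r   = trans (cong (ℤ._* (+ (q ^ m) ℤ.- + (q ^ r))) (prodT-vanishes r (≤∧≢⇒< m≤r m≢r)))
                           (ℤₚ.*-zeroˡ (+ (q ^ m) ℤ.- + (q ^ r)))

    prodT≡prodℕ : ∀ r → prodT (+ (q ^ m)) q r ≡ + prodℕ q (q ^ m) r
    prodT≡prodℕ zero    = refl
    prodT≡prodℕ (suc r) with q ^ r ≤? q ^ m
    ... | yes qʳ≤qᵐ = begin
        prodT (+ (q ^ m)) q r ℤ.* (+ (q ^ m) ℤ.- + (q ^ r))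
      ≡⟨ cong₂ ℤ._*_ (prodT≡prodℕ r) (trans (ℤₚ.m-n≡m⊖n (q ^ m) (q ^ r)) (ℤₚ.⊖-≥ qʳ≤qᵐ)) ⟩
        + prodℕ q (q ^ m) r ℤ.* + (q ^ m ∸ q ^ r)
      ≡⟨ sym (ℤₚ.pos-* (prodℕ q (q ^ m) r) _) ⟩
        + prodℕ q (q ^ m) (suc r) ∎
      where open ≡-Reasoning
    ... | no qʳ≰qᵐ = trans (prodT-vanishes (suc r) (s≤s m≤r))
                           (cong +_ (sym (prodℕ-vanishes (suc r) (s≤s m≤r))))
      where
      m≤r : m ≤ r
      m≤r = <⇒≤ (≰⇒> (λ r≤m → qʳ≰qᵐ (^-monoʳ-≤ q r≤m)))

  coeffOf : ℕ → ℕ → Monomial → ℤ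
  coeffOf a b (z , i , j) with does (i ℕ.≟ a) | does (j ℕ.≟ b)
  ... | true | true = z
  ... | _    | _    = + 0

  coeffXY-∷ : ∀ a b m ms → coeffXY a b (m ∷ ms) ≡ coeffOf a b m ℤ.+ coeffXY a b ms
  coeffXY-∷ a b (z , i , j) ms with does (i ℕ.≟ a) | does (j ℕ.≟ b)
  ... | true  | true  = refl
  ... | true  | false = sym (ℤₚ.+-identityˡ _)
  ... | false | true  = sym (ℤₚ.+-identityˡ _)
  ... | false | false = sym (ℤₚ.+-identityˡ _)

  coeffXY-++ : ∀ a b xs ys → coeffXY a b (xs ++ ys) ≡ coeffXY a b xs ℤ.+ coeffXY a b ys
  coeffXY-++ a b []       ys = sym (ℤₚ.+-identityˡ _)
  coeffXY-++ a b (m ∷ xs) ys = begin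
      coeffXY a b (m ∷ xs ++ ys)
    ≡⟨ coeffXY-∷ a b m (xs ++ ys) ⟩
      coeffOf a b m ℤ.+ coeffXY a b (xs ++ ys)
    ≡⟨ cong (λ s → coeffOf a b m ℤ.+ s) (coeffXY-++ a b xs ys) ⟩
      coeffOf a b m ℤ.+ (coeffXY a b xs ℤ.+ coeffXY a b ys)
    ≡⟨ sym (ℤₚ.+-assoc (coeffOf a b m) _ _) ⟩
      (coeffOf a b m ℤ.+ coeffXY a b xs) ℤ.+ coeffXY a b ys
    ≡⟨ cong (ℤ._+ coeffXY a b ys) (sym (coeffXY-∷ a b m xs)) ⟩
      coeffXY a b (m ∷ xs) ℤ.+ coeffXY a b ys ∎
    where open ≡-Reasoning

  coeffXY-map : ∀ {A : Set a} a b (h : A → Monomial) (g : A → ℕ) →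
    (∀ r → coeffOf a b (h r) ≡ + g r) → ∀ xs → coeffXY a b (map h xs) ≡ + ∑ g xs
  coeffXY-map a b h g h≗g []       = refl
  coeffXY-map a b h g h≗g (r ∷ xs) =
    trans (coeffXY-∷ a b (h r) (map h xs))
          (trans (cong₂ ℤ._+_ (h≗g r) (coeffXY-map a b h g h≗g xs)) (sym (ℤₚ.pos-+ (g r) _)))

  coeffOf-sameDegree : ∀ {a b i j} z → a + b ≡ i + j →
    coeffOf a b (+ z , i , j) ≡ + (𝟙 (does (j ℕ.≟ b)) * z)
  coeffOf-sameDegree {a} {b} {i} {j} z a+b≡i+j with j ℕ.≟ b
  ... | no j≢b rewrite ≡ᵇ-false j≢b with i ≡ᵇ a
  ...   | true  = refl
  ...   | false = refl
  coeffOf-sameDegree {a} {b} {i} {j} z a+b≡i+j | yes refl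
    rewrite ≡ᵇ-true (sym (+-cancelʳ-≡ j a i a+b≡i+j)) | ≡ᵇ-true {j} refl =
    cong +_ (sym (+-identityʳ z))

  coeffOf-otherDegree : ∀ {a b i j} z → a + b ≢ i + j → coeffOf a b (z , i , j) ≡ + 0
  coeffOf-otherDegree {a} {b} {i} {j} z a+b≢i+j with i ℕ.≟ a | j ℕ.≟ b
  ... | yes refl | yes refl = ⊥-elim (a+b≢i+j refl)
  ... | yes refl | no j≢b rewrite ≡ᵇ-true {i} refl | ≡ᵇ-false j≢b = refl
  ... | no  i≢a  | _      rewrite ≡ᵇ-false i≢a = refl

  -- Among the Q words y·𝟏 + x·G′ of a given linear part x of F_q-rank ρ, those with
  -- y in the F_q-span of x (q^ρ of them) have weight q^k − q^(k−ρ) and the other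
  -- Q − q^ρ have full weight q^k; wordsOfRank counts how many have weight b.
  wordsOfRank : (q k Q b ρ : ℕ) → ℕ
  wordsOfRank q k Q b ρ =
    q ^ ρ * 𝟙 (does (q ^ k ∸ q ^ (k ∸ ρ) ℕ.≟ b)) + (Q ∸ q ^ ρ) * 𝟙 (does (q ^ k ℕ.≟ b))

  module _ (q k m : ℕ) .{{_ : NonZero q}} (a b : ℕ) where
    private
      n Q : ℕ
      n = q ^ k
      Q = q ^ m

      ranks : List ℕ
      ranks = upTo (suc k)

      -- the monomials of the first sum (reindexed by r − 1) and of the second sum
      fullWeightTerm lowWeightTerm : ℕ → Monomial
      fullWeightTerm r = (prodT (+ Q) q (suc r) ℤ.* + gauss q k r , 0 , n)
      lowWeightTerm  r = (prodT (+ Q) q r ℤ.* + (q ^ r * gauss q k r) , q ^ (k ∸ r) , n ∸ q ^ (k ∸ r))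

      coeffXY-rmFormula : coeffXY a b (rmFormula q (suc k) (+ Q)) ≡
        coeffXY a b (map fullWeightTerm ranks) ℤ.+ coeffXY a b (map lowWeightTerm ranks)
      coeffXY-rmFormula =
        trans (cong (λ ms → coeffXY a b (ms ++ map lowWeightTerm ranks)) (sym (map-∘ {g = λ r → prodT (+ Q) q r ℤ.* + gauss q k (r ∸ 1) , 0 , n} {f = suc} ranks)))
              (coeffXY-++ a b (map fullWeightTerm ranks) (map lowWeightTerm ranks))

      monomial-value : ∀ r g → prodT (+ Q) q r ℤ.* + g ≡ + (prodℕ q Q r * g)
      monomial-value r g = trans (cong (ℤ._* + g) (prodT≡prodℕ q m r)) (sym (ℤₚ.pos-* (prodℕ q Q r) g))

      lowDegree : ∀ r → q ^ (k ∸ r) + (n ∸ q ^ (k ∸ r)) ≡ n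
      lowDegree r = m+[n∸m]≡n (^-monoʳ-≤ q (m∸n≤m k r))

    rmFormula-coeff : a + b ≡ n →
      coeffXY a b (rmFormula q (suc k) (+ Q)) ≡
        + ∑< (suc k) (λ r → gauss q k r * prodℕ q Q r * wordsOfRank q k Q b r)
    rmFormula-coeff a+b≡n = begin
        coeffXY a b (rmFormula q (suc k) (+ Q))
      ≡⟨ coeffXY-rmFormula ⟩
        coeffXY a b (map fullWeightTerm ranks) ℤ.+ coeffXY a b (map lowWeightTerm ranks)
      ≡⟨ cong₂ ℤ._+_ (coeffXY-map a b fullWeightTerm fullWeight fullWeight-coeff ranks)
                     (coeffXY-map a b lowWeightTerm lowWeight lowWeight-coeff ranks) ⟩
        + ∑ fullWeight ranks ℤ.+ + ∑ lowWeight ranks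
      ≡⟨ sym (ℤₚ.pos-+ (∑ fullWeight ranks) _) ⟩
        + (∑ fullWeight ranks + ∑ lowWeight ranks)
      ≡⟨ cong +_ (sym (∑-+ fullWeight lowWeight ranks)) ⟩
        + ∑ (λ r → fullWeight r + lowWeight r) ranks
      ≡⟨ cong +_ (∑-upTo _ (suc k)) ⟩
        + ∑< (suc k) (λ r → fullWeight r + lowWeight r)
      ≡⟨ cong +_ (∑<-cong (suc k) regroup) ⟩
        + ∑< (suc k) (λ r → gauss q k r * prodℕ q Q r * wordsOfRank q k Q b r) ∎
      where
      open ≡-Reasoning
      fullWeight lowWeight : ℕ → ℕ
      fullWeight r = 𝟙 (does (n ℕ.≟ b)) * (prodℕ q Q (suc r) * gauss q k r)
      lowWeight  r = 𝟙 (does (n ∸ q ^ (k ∸ r) ℕ.≟ b)) * (prodℕ q Q r * (q ^ r * gauss q k r))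

      fullWeight-coeff : ∀ r → coeffOf a b (fullWeightTerm r) ≡ + fullWeight r
      fullWeight-coeff r = trans (cong (λ z → coeffOf a b (z , 0 , n)) (monomial-value (suc r) _))
                                 (coeffOf-sameDegree {a} {b} {0} {n} _ a+b≡n)

      lowWeight-coeff : ∀ r → coeffOf a b (lowWeightTerm r) ≡ + lowWeight r
      lowWeight-coeff r =
        trans (cong (λ z → coeffOf a b (z , q ^ (k ∸ r) , n ∸ q ^ (k ∸ r))) (monomial-value r _))
              (coeffOf-sameDegree {a} {b} {q ^ (k ∸ r)} _ (trans a+b≡n (sym (lowDegree r))))

      regroup : ∀ r → fullWeight r + lowWeight r ≡ gauss q k r * prodℕ q Q r * wordsOfRank q k Q b r
      regroup r = identity (𝟙 (does (n ℕ.≟ b))) (𝟙 (does (n ∸ q ^ (k ∸ r) ℕ.≟ b)))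
                           (prodℕ q Q r) (Q ∸ q ^ r) (q ^ r) (gauss q k r)
        where
        identity : ∀ i₁ i₂ P D c g → i₁ * (P * D * g) + i₂ * (P * (c * g)) ≡ g * P * (c * i₂ + D * i₁)
        identity = solve-∀

    rmFormula-coeff-otherDegree : a + b ≢ n → coeffXY a b (rmFormula q (suc k) (+ Q)) ≡ + 0
    rmFormula-coeff-otherDegree a+b≢n = begin
        coeffXY a b (rmFormula q (suc k) (+ Q))
      ≡⟨ coeffXY-rmFormula ⟩
        coeffXY a b (map fullWeightTerm ranks) ℤ.+ coeffXY a b (map lowWeightTerm ranks)
      ≡⟨ cong₂ ℤ._+_
           (coeffXY-map a b fullWeightTerm (λ _ → 0) (λ r → coeffOf-otherDegree {a} {b} {0} {n} _ a+b≢n) ranks)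
           (coeffXY-map a b lowWeightTerm (λ _ → 0)
              (λ r → coeffOf-otherDegree {a} {b} {q ^ (k ∸ r)} _ (λ eq → a+b≢n (trans eq (lowDegree r)))) ranks) ⟩
        + ∑ (λ _ → 0) ranks ℤ.+ + ∑ (λ _ → 0) ranks
      ≡⟨ cong (λ z → + z ℤ.+ + z) (∑-zero (λ _ → refl) ranks) ⟩
        + 0 ∎
      where open ≡-Reasoning

open Formula

-- The weight enumerator of RM_q(1,k) ⊗ K for a finite field K = F_Q containing F = F_q.
module Counting {c ℓ c′ ℓ′ : Level} {q Q : ℕ} (F : FiniteField c ℓ q) (K : FiniteField c′ ℓ′ Q)
  (ι : FiniteField.Carrier F → FiniteField.Carrier K) (hom : IsFieldHom F K ι) (k : ℕ) where

  open RM F K ι k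
  open FiniteField K
  module F where
    open FiniteField F public
    from : Fin q → FiniteField.Carrier F
    from = Inverse.from (FiniteField.enum F)
  module Hom = RingMorphisms.IsRingHomomorphism hom
  open import Algebra.Properties.Ring ring
    using (xyx⁻¹≈y; //-rightDividesˡ; -‿+-comm; -‿involutive; x[y-z]≈xy-xz; -1*x≈-x)
  open import Algebra.Properties.CommutativeSemigroup +-commutativeSemigroup using (interchange)
  module Fₚ = Algebra.Properties.Ring F.ring
  module ≈-Reasoning = Relation.Binary.Reasoning.Setoid setoid

  -- F_q has an element, so q ≠ 0.
  instance
    q-nonZero : NonZero q
    q-nonZero = Finₚ.nonZeroIndex (Inverse.to F.enum F.0#)

  move-left : ∀ {c d t} → c + d ≈ t → d ≈ t - c
  move-left {c} {d} c+d≈t = trans (sym (xyx⁻¹≈y c d)) (+-congʳ c+d≈t)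

  move-right : ∀ {c d t} → d ≈ t - c → c + d ≈ t
  move-right {c} {d} {t} d≈t-c = trans (+-congˡ d≈t-c) (trans (+-comm c (t - c)) (//-rightDividesˡ c t))

  sub-sub : ∀ t p r → (t - p) - (t - r) ≈ r - p
  sub-sub t p r = begin
    (t - p) - (t - r)        ≈⟨ +-congˡ (trans (sym (-‿+-comm t (- r))) (+-congˡ (-‿involutive r))) ⟩
    (t + - p) + (- t + r)    ≈⟨ interchange t (- p) (- t) r ⟩
    (t - t) + (- p + r)      ≈⟨ +-congʳ (-‿inverseʳ t) ⟩
    0# + (- p + r)           ≈⟨ +-identityˡ _ ⟩
    - p + r                  ≈⟨ +-comm (- p) r ⟩
    r - p ∎
    where open ≈-Reasoning

  ι-cong : ∀ {x y} → x F.≈ y → ι x ≈ ι y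
  ι-cong = Hom.⟦⟧-cong

  ι-sub : ∀ x y → ι (x F.- y) ≈ ι x - ι y
  ι-sub x y = trans (Hom.+-homo x (F.- y)) (+-congˡ (Hom.-‿homo y))

  el-to : ∀ z → el (Inverse.to F.enum z) ≈ ι z
  el-to z = ι-cong (Inverse.inverseʳ F.enum ≡.refl)

  from-injective : ∀ {a b} → F.from a F.≈ F.from b → a ≡ b
  from-injective {a} {b} eq =
    ≡.trans (≡.sym (Inverse.inverseˡ F.enum F.refl)) (Inverse.inverseˡ F.enum eq)

  -- InSpan x t : t lies in the F_q-span of the entries of x ∈ K^j, i.e. t = x·u for
  -- some u ∈ F_q^j (peeling off the first coordinate of u).
  InSpan : ∀ {j} → Vector Carrier j → Carrier → Set ℓ′
  InSpan {zero}  x t = t ≈ 0#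
  InSpan {suc j} x t = Σ (Fin q) λ a → InSpan (tail x) (t - head x * el a)

  inSpan? : ∀ {j} (x : Vector Carrier j) t → Dec (InSpan x t)
  inSpan? {zero}  x t = t ≟ 0#
  inSpan? {suc j} x t = Finₚ.any? (λ a → inSpan? (tail x) (t - head x * el a))

  InSpan-resp : ∀ {j} (x : Vector Carrier j) {t t′} → t ≈ t′ → InSpan x t → InSpan x t′
  InSpan-resp {zero}  x t≈t′ t≈0       = trans (sym t≈t′) t≈0
  InSpan-resp {suc j} x t≈t′ (a , rest) = a , InSpan-resp (tail x) (+-congʳ t≈t′) rest

  InSpan-+ : ∀ {j} (x : Vector Carrier j) {t t′} → InSpan x t → InSpan x t′ → InSpan x (t + t′)
  InSpan-+ {zero}  x t≈0 t′≈0 = trans (+-cong t≈0 t′≈0) (+-identityʳ 0#)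
  InSpan-+ {suc j} x {t} {t′} (a , rest) (a′ , rest′) =
    Inverse.to F.enum (F.from a F.+ F.from a′) , InSpan-resp (tail x) (sym regroup) (InSpan-+ (tail x) rest rest′)
    where
    x₀ : Carrier
    x₀ = head x
    regroup : (t + t′) - x₀ * el (Inverse.to F.enum (F.from a F.+ F.from a′)) ≈ (t - x₀ * el a) + (t′ - x₀ * el a′)
    regroup = begin
      (t + t′) - x₀ * el (Inverse.to F.enum (F.from a F.+ F.from a′))
        ≈⟨ +-congˡ (-‿cong (*-congˡ (trans (el-to _) (Hom.+-homo _ _)))) ⟩
      (t + t′) - x₀ * (el a + el a′)
        ≈⟨ +-congˡ (-‿cong (distribˡ x₀ (el a) (el a′))) ⟩
      (t + t′) - (x₀ * el a + x₀ * el a′)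
        ≈⟨ +-congˡ (sym (-‿+-comm _ _)) ⟩
      (t + t′) + (- (x₀ * el a) + - (x₀ * el a′))
        ≈⟨ interchange t t′ _ _ ⟩
      (t - x₀ * el a) + (t′ - x₀ * el a′) ∎
      where open ≈-Reasoning

  InSpan-scale : ∀ {j} (x : Vector Carrier j) (s : F.Carrier) {t} → InSpan x t → InSpan x (ι s * t)
  InSpan-scale {zero}  x s t≈0 = trans (*-congˡ t≈0) (zeroʳ _)
  InSpan-scale {suc j} x s {t} (a , rest) =
    Inverse.to F.enum (s F.* F.from a) , InSpan-resp (tail x) (sym regroup) (InSpan-scale (tail x) s rest)
    where
    x₀ : Carrier
    x₀ = head x
    regroup : ι s * t - x₀ * el (Inverse.to F.enum (s F.* F.from a)) ≈ ι s * (t - x₀ * el a)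
    regroup = begin
      ι s * t - x₀ * el (Inverse.to F.enum (s F.* F.from a))
        ≈⟨ +-congˡ (-‿cong (*-congˡ (trans (el-to _) (Hom.*-homo _ _)))) ⟩
      ι s * t - x₀ * (ι s * el a)
        ≈⟨ +-congˡ (-‿cong (trans (sym (*-assoc _ _ _)) (trans (*-congʳ (*-comm x₀ (ι s))) (*-assoc _ _ _)))) ⟩
      ι s * t - ι s * (x₀ * el a)
        ≈⟨ sym (x[y-z]≈xy-xz (ι s) t _) ⟩
      ι s * (t - x₀ * el a) ∎
      where open ≈-Reasoning

  InSpan-neg : ∀ {j} (x : Vector Carrier j) {t} → InSpan x t → InSpan x (- t)
  InSpan-neg x {t} t∈ = InSpan-resp x minus-one (InSpan-scale x (F.- F.1#) t∈)
    where
    minus-one : ι (F.- F.1#) * t ≈ - t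
    minus-one = trans (*-congʳ (trans (Hom.-‿homo F.1#) (-‿cong Hom.1#-homo))) (-1*x≈-x t)

  InSpan-neg⁻ : ∀ {j} (x : Vector Carrier j) {t} → InSpan x (- t) → InSpan x t
  InSpan-neg⁻ x -t∈ = InSpan-resp x (-‿involutive _) (InSpan-neg x -t∈)

  InSpan-− : ∀ {j} (x : Vector Carrier j) {t t′} → InSpan x t → InSpan x t′ → InSpan x (t - t′)
  InSpan-− x t∈ t′∈ = InSpan-+ x t∈ (InSpan-neg x t′∈)

  InSpan-*el : ∀ {j} (x : Vector Carrier j) {t} a → InSpan x t → InSpan x (t * el a)
  InSpan-*el x a t∈ = InSpan-resp x (*-comm _ _) (InSpan-scale x (F.from a) t∈)

  InSpan-shift : ∀ {j} (x : Vector Carrier j) {v t} a → InSpan x v →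
    InSpan x (t - v * el a) ⇔ InSpan x t
  InSpan-shift x {v} {t} a v∈ = mk⇔
    (λ t-va∈ → InSpan-resp x (//-rightDividesˡ (v * el a) t) (InSpan-+ x t-va∈ (InSpan-*el x a v∈)))
    (λ t∈ → InSpan-− x t∈ (InSpan-*el x a v∈))

  coefficient-unique : ∀ {j} (x : Vector Carrier j) {v t} → ¬ InSpan x v → ∀ a b →
    InSpan x (t - v * el a) → InSpan x (t - v * el b) → a ≡ b
  coefficient-unique x {v} {t} v∉ a b a∈ b∈ with a Fin.≟ b
  ... | yes a≡b = a≡b
  ... | no  a≢b = ⊥-elim (v∉ (InSpan-resp x v-recovered (InSpan-scale x d⁻¹ v·d∈)))
    where
    d : F.Carrier
    d = F.from a F.- F.from b
    d≉0 : ¬ d F.≈ F.0#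
    d≉0 d≈0 = a≢b (from-injective (Fₚ.x∙y⁻¹≈ε⇒x≈y _ _ d≈0))
    d⁻¹ : F.Carrier
    d⁻¹ = proj₁ (IsField.inv F.isField d d≉0)
    v·d∈ : InSpan x (v * ι d)
    v·d∈ = InSpan-resp x difference (InSpan-− x b∈ a∈)
      where
      difference : (t - v * el b) - (t - v * el a) ≈ v * ι d
      difference = begin
        (t - v * el b) - (t - v * el a) ≈⟨ sub-sub t _ _ ⟩
        v * el a - v * el b             ≈⟨ sym (x[y-z]≈xy-xz v _ _) ⟩
        v * (el a - el b)               ≈⟨ *-congˡ (sym (ι-sub _ _)) ⟩
        v * ι d ∎
        where open ≈-Reasoning
    v-recovered : ι d⁻¹ * (v * ι d) ≈ v
    v-recovered = begin
      ι d⁻¹ * (v * ι d) ≈⟨ *-comm _ _ ⟩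
      (v * ι d) * ι d⁻¹ ≈⟨ *-assoc _ _ _ ⟩
      v * (ι d * ι d⁻¹) ≈⟨ *-congˡ (sym (Hom.*-homo d d⁻¹)) ⟩
      v * ι (d F.* d⁻¹) ≈⟨ *-congˡ (trans (ι-cong (proj₂ (IsField.inv F.isField d d≉0))) Hom.1#-homo) ⟩
      v * 1#            ≈⟨ *-identityʳ v ⟩
      v ∎
      where open ≈-Reasoning

  -- The rank of x: the F_q-dimension of its span, counting the entries that are
  -- not in the span of the later ones.
  rank : ∀ {j} → Vector Carrier j → ℕ
  rank {zero}  x = 0
  rank {suc j} x = if does (inSpan? (tail x) (head x)) then rank (tail x) else suc (rank (tail x))

  rank-≤ : ∀ {j} (x : Vector Carrier j) → rank x ≤ j
  rank-≤ {zero}  x = z≤n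
  rank-≤ {suc j} x with does (inSpan? (tail x) (head x))
  ... | true  = ℕₚ.m≤n⇒m≤1+n (rank-≤ (tail x))
  ... | false = s≤s (rank-≤ (tail x))

  rank-dependent : ∀ {j} (x : Vector Carrier (suc j)) → InSpan (tail x) (head x) → rank x ≡ rank (tail x)
  rank-dependent x x₀∈ rewrite dec-true (inSpan? (tail x) (head x)) x₀∈ = ≡.refl

  rank-independent : ∀ {j} (x : Vector Carrier (suc j)) → ¬ InSpan (tail x) (head x) →
    rank x ≡ suc (rank (tail x))
  rank-independent x x₀∉ rewrite dec-false (inSpan? (tail x) (head x)) x₀∉ = ≡.refl

  InSpan-dependent : ∀ {j} (x : Vector Carrier (suc j)) {t} → InSpan (tail x) (head x) →
    InSpan (tail x) t ⇔ InSpan x t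
  InSpan-dependent x x₀∈ = mk⇔
    (λ t∈ → a₀ , Equivalence.from (InSpan-shift (tail x) a₀ x₀∈) t∈)
    (λ (a , t-x₀a∈) → Equivalence.to (InSpan-shift (tail x) a x₀∈) t-x₀a∈)
    where
    a₀ : Fin q
    a₀ = Inverse.to F.enum F.0#

  solutions : ∀ {j} → Vector Carrier j → Carrier → ℕ
  solutions {j} x t = ∑ (λ u → 𝟙 (does (dot x u ≟ t))) (allVecs q j)

  solutions-suc : ∀ {j} (x : Vector Carrier (suc j)) t →
    solutions x t ≡ ∑ (λ a → solutions (tail x) (t - head x * el a)) (allFin q)
  solutions-suc {j} x t = begin
      solutions x t
    ≡⟨ ∑-concatMap _ (λ a → map (a ∷_) (allVecs q j)) (allFin q) ⟩
      ∑ (λ a → ∑ (λ u → 𝟙 (does (dot x u ≟ t))) (map (a ∷_) (allVecs q j))) (allFin q)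
    ≡⟨ ∑-cong (λ a → ≡.trans (∑-map _ (a ∷_) (allVecs q j)) (∑-cong (λ u → ≡.cong 𝟙
         (does-⇔ (mk⇔ move-left move-right) (dot x (a ∷ u) ≟ t) (dot (tail x) u ≟ (t - head x * el a)))) (allVecs q j))) (allFin q) ⟩
      ∑ (λ a → solutions (tail x) (t - head x * el a)) (allFin q) ∎
    where open ≡.≡-Reasoning

  shifts : ∀ {j} → Vector Carrier (suc j) → Carrier → ℕ
  shifts x t = ∑ (λ a → 𝟙 (does (inSpan? (tail x) (t - head x * el a)))) (allFin q)

  shifts-dependent : ∀ {j} (x : Vector Carrier (suc j)) t → InSpan (tail x) (head x) →
    shifts x t ≡ q ℕ.* 𝟙 (does (inSpan? x t))
  shifts-dependent x t x₀∈ = begin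
      shifts x t
    ≡⟨ ∑-cong (λ a → ≡.cong 𝟙 (does-⇔ (InSpan-shift (tail x) a x₀∈) (inSpan? (tail x) (t - head x * el a)) (inSpan? (tail x) t))) (allFin q) ⟩
      ∑ (λ _ → 𝟙 (does (inSpan? (tail x) t))) (allFin q)
    ≡⟨ ∑-const _ (allFin q) ⟩
      length (allFin q) ℕ.* 𝟙 (does (inSpan? (tail x) t))
    ≡⟨ ≡.cong₂ ℕ._*_ (length-tabulate {n = q} id) (≡.cong 𝟙 (does-⇔ (InSpan-dependent x x₀∈) (inSpan? (tail x) t) (inSpan? x t))) ⟩
      q ℕ.* 𝟙 (does (inSpan? x t)) ∎
    where open ≡.≡-Reasoning

  shifts-independent : ∀ {j} (x : Vector Carrier (suc j)) t → ¬ InSpan (tail x) (head x) →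
    shifts x t ≡ 𝟙 (does (inSpan? x t))
  shifts-independent x t x₀∉ with inSpan? x t
  ... | yes (a , t-x₀a∈) = ∑-tabulate-unique (λ a → inSpan? (tail x) (t - head x * el a)) id a t-x₀a∈
                             (λ a′ t-x₀a′∈ → coefficient-unique (tail x) x₀∉ a′ a t-x₀a′∈ t-x₀a∈)
  ... | no  t∉           = ∑-tabulate-none (λ a → inSpan? (tail x) (t - head x * el a)) id
                             (λ a t-x₀a∈ → t∉ (a , t-x₀a∈))

  -- The solution set of x·u = t is empty or a coset of the kernel, of size q^(j − rank x).
  solutions≡ : ∀ {j} (x : Vector Carrier j) t →
    solutions x t ≡ 𝟙 (does (inSpan? x t)) ℕ.* q ^ (j ∸ rank x)
  solutions≡ {zero}  x t = ≡.trans (ℕₚ.+-identityʳ _)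
    (≡.trans (≡.cong 𝟙 (does-⇔ (mk⇔ sym sym) (0# ≟ t) (t ≟ 0#))) (≡.sym (ℕₚ.*-identityʳ _)))
  solutions≡ {suc j} x t = begin
      solutions x t
    ≡⟨ solutions-suc x t ⟩
      ∑ (λ a → solutions (tail x) (t - head x * el a)) (allFin q)
    ≡⟨ ∑-cong (λ a → solutions≡ (tail x) _) (allFin q) ⟩
      ∑ (λ a → 𝟙 (does (inSpan? (tail x) (t - head x * el a))) ℕ.* q ^ (j ∸ rank (tail x))) (allFin q)
    ≡⟨ ∑-*ʳ _ _ (allFin q) ⟩
      shifts x t ℕ.* q ^ (j ∸ rank (tail x))
    ≡⟨ by-dependence (inSpan? (tail x) (head x)) ⟩
      𝟙 (does (inSpan? x t)) ℕ.* q ^ (suc j ∸ rank x) ∎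
    where
    open ≡.≡-Reasoning
    by-dependence : Dec (InSpan (tail x) (head x)) →
      shifts x t ℕ.* q ^ (j ∸ rank (tail x)) ≡ 𝟙 (does (inSpan? x t)) ℕ.* q ^ (suc j ∸ rank x)
    by-dependence (yes x₀∈) = begin
        shifts x t ℕ.* q ^ (j ∸ rank (tail x))
      ≡⟨ ≡.cong (ℕ._* q ^ (j ∸ rank (tail x))) (shifts-dependent x t x₀∈) ⟩
        q ℕ.* 𝟙 (does (inSpan? x t)) ℕ.* q ^ (j ∸ rank (tail x))
      ≡⟨ move-q q (𝟙 (does (inSpan? x t))) (q ^ (j ∸ rank (tail x))) ⟩
        𝟙 (does (inSpan? x t)) ℕ.* q ^ suc (j ∸ rank (tail x))
      ≡⟨ ≡.cong (λ e → 𝟙 (does (inSpan? x t)) ℕ.* q ^ e)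
           (≡.trans (≡.sym (ℕₚ.+-∸-assoc 1 (rank-≤ (tail x)))) (≡.cong (suc j ∸_) (≡.sym (rank-dependent x x₀∈)))) ⟩
        𝟙 (does (inSpan? x t)) ℕ.* q ^ (suc j ∸ rank x) ∎
      where
      move-q : ∀ m n o → m ℕ.* n ℕ.* o ≡ n ℕ.* (m ℕ.* o)
      move-q = solve-∀
    by-dependence (no x₀∉) = ≡.cong₂ (λ i r → i ℕ.* q ^ (suc j ∸ r))
      (shifts-independent x t x₀∉) (≡.sym (rank-independent x x₀∉))

  elements : List Carrier
  elements = tabulate (Inverse.from enum)

  length-elements : length elements ≡ Q
  length-elements = length-tabulate (Inverse.from enum)

  elements-unique : Unique setoid elements
  elements-unique = Uniqueₚ.tabulate⁺ setoid
    (λ {i} {j} eq → ≡.trans (≡.sym (Inverse.inverseˡ enum refl)) (Inverse.inverseˡ enum eq))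

  elements-complete : ∀ y → Membership._∈_ setoid y elements
  elements-complete y = Anyₚ.tabulate⁺ (Inverse.to enum y) (sym (Inverse.inverseʳ enum ≡.refl))

  count-equal : ∀ d → ∑ (λ z → 𝟙 (does (d ≟ z))) elements ≡ 1
  count-equal d = ∑-tabulate-unique (d ≟_) (Inverse.from enum) (Inverse.to enum d)
    (sym (Inverse.inverseʳ enum ≡.refl)) (λ i d≈i → ≡.sym (Inverse.inverseˡ enum d≈i))

  count-allVecs : ∀ j → ∑ (λ _ → 1) (allVecs q j) ≡ q ^ j
  count-allVecs zero    = ≡.refl
  count-allVecs (suc j) = begin
      ∑ (λ _ → 1) (allVecs q (suc j))
    ≡⟨ ∑-concatMap _ (λ a → map (a ∷_) (allVecs q j)) (allFin q) ⟩
      ∑ (λ a → ∑ (λ _ → 1) (map (a ∷_) (allVecs q j))) (allFin q)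
    ≡⟨ ∑-cong (λ a → ≡.trans (∑-map _ (a ∷_) (allVecs q j)) (count-allVecs j)) (allFin q) ⟩
      ∑ (λ _ → q ^ j) (allFin q)
    ≡⟨ ∑-const _ (allFin q) ⟩
      length (allFin q) ℕ.* q ^ j
    ≡⟨ ≡.cong (ℕ._* q ^ j) (length-tabulate {n = q} id) ⟩
      q ^ suc j ∎
    where open ≡.≡-Reasoning

  -- The span of x has q^(rank x) elements: summing the solution counts over all
  -- t ∈ K counts every u ∈ F_q^j once.
  spanSize : ∀ {j} (x : Vector Carrier j) → ∑ (λ t → 𝟙 (does (inSpan? x t))) elements ≡ q ^ rank x
  spanSize {j} x = ℕₚ.*-cancelʳ-≡ _ _ (q ^ (j ∸ rank x)) {{ℕₚ.m^n≢0 q (j ∸ rank x)}} (begin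
      ∑ (λ t → 𝟙 (does (inSpan? x t))) elements ℕ.* q ^ (j ∸ rank x)
    ≡⟨ ≡.sym (∑-*ʳ _ _ elements) ⟩
      ∑ (λ t → 𝟙 (does (inSpan? x t)) ℕ.* q ^ (j ∸ rank x)) elements
    ≡⟨ ≡.sym (∑-cong (solutions≡ x) elements) ⟩
      ∑ (λ t → ∑ (λ u → 𝟙 (does (dot x u ≟ t))) (allVecs q j)) elements
    ≡⟨ ∑-swap (λ t u → 𝟙 (does (dot x u ≟ t))) elements (allVecs q j) ⟩
      ∑ (λ u → ∑ (λ t → 𝟙 (does (dot x u ≟ t))) elements) (allVecs q j)
    ≡⟨ ∑-cong (λ u → count-equal (dot x u)) (allVecs q j) ⟩
      ∑ (λ _ → 1) (allVecs q j)
    ≡⟨ count-allVecs j ⟩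
      q ^ j
    ≡⟨ ≡.cong (q ^_) (≡.sym (ℕₚ.m+[n∸m]≡n (rank-≤ x))) ⟩
      q ^ (rank x ℕ.+ (j ∸ rank x))
    ≡⟨ ℕₚ.^-distribˡ-+-* q (rank x) (j ∸ rank x) ⟩
      q ^ rank x ℕ.* q ^ (j ∸ rank x) ∎)
    where open ≡.≡-Reasoning

  module Tuples = Listing setoid
  open Tuples using (tuples; _∈ᵗ_; ≋-setoid) renaming (_≋_ to _≋ᵗ_)

  rankCount : ℕ → ℕ → ℕ
  rankCount j r = ∑ (λ x → 𝟙 (rank x ≡ᵇ r)) (tuples elements j)

  extensionsOfRank : ∀ {j} (x : Vector Carrier j) r →
    ∑ (λ y → 𝟙 (rank (y ◂ x) ≡ᵇ r)) elements ≡
      q ^ rank x ℕ.* 𝟙 (rank x ≡ᵇ r) ℕ.+ (Q ∸ q ^ rank x) ℕ.* 𝟙 (suc (rank x) ≡ᵇ r)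
  extensionsOfRank x r = begin
      ∑ (λ y → 𝟙 (rank (y ◂ x) ≡ᵇ r)) elements
    ≡⟨ ∑-cong (λ y → if-float (λ ρ → 𝟙 (ρ ≡ᵇ r)) (does (inSpan? x y))) elements ⟩
      ∑ (λ y → if does (inSpan? x y) then 𝟙 (rank x ≡ᵇ r) else 𝟙 (suc (rank x) ≡ᵇ r)) elements
    ≡⟨ ∑-if (λ y → does (inSpan? x y)) _ _ elements ⟩
      ∑ (λ y → 𝟙 (does (inSpan? x y))) elements ℕ.* 𝟙 (rank x ≡ᵇ r)
        ℕ.+ (length elements ∸ ∑ (λ y → 𝟙 (does (inSpan? x y))) elements) ℕ.* 𝟙 (suc (rank x) ≡ᵇ r)
    ≡⟨ ≡.cong₂ (λ s l → s ℕ.* 𝟙 (rank x ≡ᵇ r) ℕ.+ (l ∸ s) ℕ.* 𝟙 (suc (rank x) ≡ᵇ r))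
         (spanSize x) length-elements ⟩
      q ^ rank x ℕ.* 𝟙 (rank x ≡ᵇ r) ℕ.+ (Q ∸ q ^ rank x) ℕ.* 𝟙 (suc (rank x) ≡ᵇ r) ∎
    where open ≡.≡-Reasoning

  rankCount-suc : ∀ j r → rankCount (suc j) r ≡
    rankCount j r ℕ.* q ^ r ℕ.+ ∑ (λ x → (Q ∸ q ^ rank x) ℕ.* 𝟙 (suc (rank x) ≡ᵇ r)) (tuples elements j)
  rankCount-suc j r = begin
      rankCount (suc j) r
    ≡⟨ Tuples.∑-tuples-suc (λ x → 𝟙 (rank x ≡ᵇ r)) elements ⟩
      ∑ (λ x → ∑ (λ y → 𝟙 (rank (y ◂ x) ≡ᵇ r)) elements) (tuples elements j)
    ≡⟨ ∑-cong (λ x → extensionsOfRank x r) (tuples elements j) ⟩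
      ∑ (λ x → q ^ rank x ℕ.* 𝟙 (rank x ≡ᵇ r) ℕ.+ (Q ∸ q ^ rank x) ℕ.* 𝟙 (suc (rank x) ≡ᵇ r)) (tuples elements j)
    ≡⟨ ∑-+ _ _ (tuples elements j) ⟩
      ∑ (λ x → q ^ rank x ℕ.* 𝟙 (rank x ≡ᵇ r)) (tuples elements j)
        ℕ.+ ∑ (λ x → (Q ∸ q ^ rank x) ℕ.* 𝟙 (suc (rank x) ≡ᵇ r)) (tuples elements j)
    ≡⟨ ≡.cong (ℕ._+ ∑ (λ x → (Q ∸ q ^ rank x) ℕ.* 𝟙 (suc (rank x) ≡ᵇ r)) (tuples elements j))
         (≡.trans (∑-cong (λ x → 𝟙-≡ᵇ-subst (q ^_) (rank x) r) (tuples elements j))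
                  (∑-*ʳ _ _ (tuples elements j))) ⟩
      rankCount j r ℕ.* q ^ r ℕ.+ ∑ (λ x → (Q ∸ q ^ rank x) ℕ.* 𝟙 (suc (rank x) ≡ᵇ r)) (tuples elements j) ∎
    where open ≡.≡-Reasoning

  rankCount≡ : ∀ j r → rankCount j r ≡ gauss q j r ℕ.* prodℕ q Q r
  rankCount≡ zero    zero    = ≡.refl
  rankCount≡ zero    (suc r) = ≡.refl
  rankCount≡ (suc j) zero    = begin
      rankCount (suc j) 0
    ≡⟨ rankCount-suc j 0 ⟩
      rankCount j 0 ℕ.* 1 ℕ.+ ∑ (λ x → (Q ∸ q ^ rank x) ℕ.* 0) (tuples elements j)
    ≡⟨ ≡.cong₂ (λ u v → u ℕ.* 1 ℕ.+ v) (rankCount≡ j 0)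
         (∑-zero (λ x → ℕₚ.*-zeroʳ (Q ∸ q ^ rank x)) (tuples elements j)) ⟩
      1 ∎
    where open ≡.≡-Reasoning
  rankCount≡ (suc j) (suc r) = begin
      rankCount (suc j) (suc r)
    ≡⟨ rankCount-suc j (suc r) ⟩
      rankCount j (suc r) ℕ.* q ^ suc r ℕ.+ ∑ (λ x → (Q ∸ q ^ rank x) ℕ.* 𝟙 (rank x ≡ᵇ r)) (tuples elements j)
    ≡⟨ ≡.cong (rankCount j (suc r) ℕ.* q ^ suc r ℕ.+_)
         (≡.trans (∑-cong (λ x → 𝟙-≡ᵇ-subst (λ ρ → Q ∸ q ^ ρ) (rank x) r) (tuples elements j))
                  (∑-*ʳ _ _ (tuples elements j))) ⟩
      rankCount j (suc r) ℕ.* q ^ suc r ℕ.+ rankCount j r ℕ.* (Q ∸ q ^ r)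
    ≡⟨ ≡.cong₂ (λ u v → u ℕ.* q ^ suc r ℕ.+ v ℕ.* (Q ∸ q ^ r)) (rankCount≡ j (suc r)) (rankCount≡ j r) ⟩
      gauss q j (suc r) ℕ.* (prodℕ q Q r ℕ.* (Q ∸ q ^ r)) ℕ.* q ^ suc r ℕ.+ gauss q j r ℕ.* prodℕ q Q r ℕ.* (Q ∸ q ^ r)
    ≡⟨ q-Pascal (gauss q j (suc r)) (prodℕ q Q r) (Q ∸ q ^ r) (q ^ suc r) (gauss q j r) ⟩
      gauss q (suc j) (suc r) ℕ.* prodℕ q Q (suc r) ∎
    where
    open ≡.≡-Reasoning
    q-Pascal : ∀ g₁ P D c g₀ → g₁ ℕ.* (P ℕ.* D) ℕ.* c ℕ.+ g₀ ℕ.* P ℕ.* D ≡ (g₀ ℕ.+ c ℕ.* g₁) ℕ.* (P ℕ.* D)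
    q-Pascal = solve-∀

  weight-zeros : ∀ w → weight w ≡ q ^ k ∸ ∑ (λ u → 𝟙 (does (w u ≟ 0#))) (allVecs q k)
  weight-zeros w = begin
      weight w
    ≡⟨ length-filter (λ u → ¬? (w u ≟ 0#)) (allVecs q k) ⟩
      ∑ (λ u → 𝟙 (not (does (w u ≟ 0#)))) (allVecs q k)
    ≡⟨ count-not (λ u → does (w u ≟ 0#)) (allVecs q k) ⟩
      length (allVecs q k) ∸ ∑ (λ u → 𝟙 (does (w u ≟ 0#))) (allVecs q k)
    ≡⟨ ≡.cong (_∸ ∑ (λ u → 𝟙 (does (w u ≟ 0#))) (allVecs q k))
         (≡.trans (≡.sym (ℕₚ.*-identityʳ _)) (≡.trans (≡.sym (∑-const 1 (allVecs q k))) (count-allVecs k))) ⟩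
      q ^ k ∸ ∑ (λ u → 𝟙 (does (w u ≟ 0#))) (allVecs q k) ∎
    where open ≡.≡-Reasoning

  weight-cong : ∀ {w w′} → w ≋ w′ → weight w ≡ weight w′
  weight-cong {w} {w′} w≋w′ = ≡.trans (weight-zeros w) (≡.trans
    (≡.cong (q ^ k ∸_) (∑-cong (λ u → ≡.cong 𝟙
      (does-⇔ (mk⇔ (trans (sym (w≋w′ u))) (trans (w≋w′ u))) (w u ≟ 0#) (w′ u ≟ 0#))) (allVecs q k)))
    (≡.sym (weight-zeros w′)))

  -- The codeword with constant part y and linear part x vanishes exactly on the
  -- solutions of x·u = −y.
  weight-encode : ∀ (x : Vector Carrier k) y →
    weight (encode (y ◂ x)) ≡ q ^ k ∸ 𝟙 (does (inSpan? x y)) ℕ.* q ^ (k ∸ rank x)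
  weight-encode x y = begin
      weight (encode (y ◂ x))
    ≡⟨ weight-zeros _ ⟩
      q ^ k ∸ ∑ (λ u → 𝟙 (does ((y + dot x u) ≟ 0#))) (allVecs q k)
    ≡⟨ ≡.cong (q ^ k ∸_) (∑-cong (λ u → ≡.cong 𝟙
         (does-⇔ zero⇔solution ((y + dot x u) ≟ 0#) (dot x u ≟ (- y)))) (allVecs q k)) ⟩
      q ^ k ∸ solutions x (- y)
    ≡⟨ ≡.cong (q ^ k ∸_) (solutions≡ x (- y)) ⟩
      q ^ k ∸ 𝟙 (does (inSpan? x (- y))) ℕ.* q ^ (k ∸ rank x)
    ≡⟨ ≡.cong (λ b → q ^ k ∸ 𝟙 b ℕ.* q ^ (k ∸ rank x))
         (does-⇔ (mk⇔ (InSpan-neg⁻ x) (InSpan-neg x)) (inSpan? x (- y)) (inSpan? x y)) ⟩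
      q ^ k ∸ 𝟙 (does (inSpan? x y)) ℕ.* q ^ (k ∸ rank x) ∎
    where
    open ≡.≡-Reasoning
    zero⇔solution : ∀ {d} → y + d ≈ 0# ⇔ d ≈ - y
    zero⇔solution = mk⇔ (λ y+d≈0 → trans (move-left y+d≈0) (+-identityˡ _))
                        (λ d≈-y → move-right (trans d≈-y (sym (+-identityˡ _))))

  wordsWithLinearPart : ∀ (x : Vector Carrier k) b →
    ∑ (λ y → 𝟙 (does (weight (encode (y ◂ x)) ℕ.≟ b))) elements ≡ wordsOfRank q k Q b (rank x)
  wordsWithLinearPart x b = begin
      ∑ (λ y → 𝟙 (does (weight (encode (y ◂ x)) ℕ.≟ b))) elements
    ≡⟨ ∑-cong weight-indicator elements ⟩
      ∑ (λ y → if does (inSpan? x y) then 𝟙 (does (q ^ k ∸ q ^ (k ∸ rank x) ℕ.≟ b))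
                                     else 𝟙 (does (q ^ k ℕ.≟ b))) elements
    ≡⟨ ∑-if (λ y → does (inSpan? x y)) _ _ elements ⟩
      ∑ (λ y → 𝟙 (does (inSpan? x y))) elements ℕ.* 𝟙 (does (q ^ k ∸ q ^ (k ∸ rank x) ℕ.≟ b))
        ℕ.+ (length elements ∸ ∑ (λ y → 𝟙 (does (inSpan? x y))) elements) ℕ.* 𝟙 (does (q ^ k ℕ.≟ b))
    ≡⟨ ≡.cong₂ (λ s l → s ℕ.* 𝟙 (does (q ^ k ∸ q ^ (k ∸ rank x) ℕ.≟ b)) ℕ.+ (l ∸ s) ℕ.* 𝟙 (does (q ^ k ℕ.≟ b)))
         (spanSize x) length-elements ⟩
      wordsOfRank q k Q b (rank x) ∎
    where
    open ≡.≡-Reasoning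
    weight-indicator : ∀ y → 𝟙 (does (weight (encode (y ◂ x)) ℕ.≟ b)) ≡
      (if does (inSpan? x y) then 𝟙 (does (q ^ k ∸ q ^ (k ∸ rank x) ℕ.≟ b)) else 𝟙 (does (q ^ k ℕ.≟ b)))
    weight-indicator y rewrite weight-encode x y with does (inSpan? x y)
    ... | true  rewrite ℕₚ.*-identityˡ (q ^ (k ∸ rank x)) = ≡.refl
    ... | false = ≡.refl

  weightCount : ∀ b → ∑ (λ x → 𝟙 (does (weight (encode x) ℕ.≟ b))) (tuples elements (suc k)) ≡
    ∑< (suc k) (λ r → gauss q k r ℕ.* prodℕ q Q r ℕ.* wordsOfRank q k Q b r)
  weightCount b = begin
      ∑ (λ x → 𝟙 (does (weight (encode x) ℕ.≟ b))) (tuples elements (suc k))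
    ≡⟨ Tuples.∑-tuples-suc (λ x → 𝟙 (does (weight (encode x) ℕ.≟ b))) elements ⟩
      ∑ (λ x → ∑ (λ y → 𝟙 (does (weight (encode (y ◂ x)) ℕ.≟ b))) elements) (tuples elements k)
    ≡⟨ ∑-cong (λ x → wordsWithLinearPart x b) (tuples elements k) ⟩
      ∑ (λ x → wordsOfRank q k Q b (rank x)) (tuples elements k)
    ≡⟨ ∑-group rank (wordsOfRank q k Q b) (suc k) (λ x → s≤s (rank-≤ x)) (tuples elements k) ⟩
      ∑< (suc k) (λ r → rankCount k r ℕ.* wordsOfRank q k Q b r)
    ≡⟨ ∑<-cong (suc k) (λ r → ≡.cong (ℕ._* wordsOfRank q k Q b r) (rankCount≡ k r)) ⟩
      ∑< (suc k) (λ r → gauss q k r ℕ.* prodℕ q Q r ℕ.* wordsOfRank q k Q b r) ∎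
    where open ≡.≡-Reasoning

  dot-cong : ∀ {j} {x x′ : Vector Carrier j} → x ≋ᵗ x′ → ∀ u → dot x u ≈ dot x′ u
  dot-cong x≋x′ []      = refl
  dot-cong x≋x′ (a ∷ u) = +-cong (*-congʳ (x≋x′ Fin.zero)) (dot-cong (x≋x′ ∘ Fin.suc) u)

  encode-cong : ∀ {x x′ : Vector Carrier (suc k)} → x ≋ᵗ x′ → encode x ≋ encode x′
  encode-cong x≋x′ u = +-cong (x≋x′ Fin.zero) (dot-cong (x≋x′ ∘ Fin.suc) u)

  zeroVec : ∀ j → Vec (Fin q) j
  zeroVec zero    = []
  zeroVec (suc j) = Inverse.to F.enum F.0# ∷ zeroVec j

  unitVec : ∀ {j} → Fin j → Vec (Fin q) j
  unitVec {suc j} Fin.zero    = Inverse.to F.enum F.1# ∷ zeroVec j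
  unitVec {suc j} (Fin.suc i) = Inverse.to F.enum F.0# ∷ unitVec i

  el-0 : el (Inverse.to F.enum F.0#) ≈ 0#
  el-0 = trans (el-to F.0#) Hom.0#-homo

  dot-zeroVec : ∀ {j} (x : Vector Carrier j) → dot x (zeroVec j) ≈ 0#
  dot-zeroVec {zero}  x = refl
  dot-zeroVec {suc j} x =
    trans (+-cong (trans (*-congˡ el-0) (zeroʳ _)) (dot-zeroVec (tail x))) (+-identityʳ 0#)

  dot-unitVec : ∀ {j} (x : Vector Carrier j) i → dot x (unitVec i) ≈ x i
  dot-unitVec {suc j} x Fin.zero =
    trans (+-cong (trans (*-congˡ (trans (el-to F.1#) Hom.1#-homo)) (*-identityʳ _)) (dot-zeroVec (tail x)))
          (+-identityʳ _)
  dot-unitVec {suc j} x (Fin.suc i) =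
    trans (+-cong (trans (*-congˡ el-0) (zeroʳ _)) (dot-unitVec (tail x) i)) (+-identityˡ _)

  -- A codeword determines its coefficient vector: evaluate at 0 and at the unit vectors.
  encode-injective : ∀ {x x′ : Vector Carrier (suc k)} → encode x ≋ encode x′ → x ≋ᵗ x′
  encode-injective {x} {x′} eq Fin.zero = begin
      x Fin.zero                      ≈⟨ sym (+-identityʳ _) ⟩
      x Fin.zero + 0#                 ≈⟨ +-congˡ (sym (dot-zeroVec (tail x))) ⟩
      encode x (zeroVec k)            ≈⟨ eq (zeroVec k) ⟩
      encode x′ (zeroVec k)           ≈⟨ +-congˡ (dot-zeroVec (tail x′)) ⟩
      x′ Fin.zero + 0#                ≈⟨ +-identityʳ _ ⟩
      x′ Fin.zero ∎
    where open ≈-Reasoning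
  encode-injective {x} {x′} eq (Fin.suc i) = begin
      x (Fin.suc i)                                 ≈⟨ move-left at-unit ⟩
      (x′ Fin.zero + x′ (Fin.suc i)) - x Fin.zero    ≈⟨ +-congˡ (-‿cong (encode-injective {x} {x′} eq Fin.zero)) ⟩
      (x′ Fin.zero + x′ (Fin.suc i)) - x′ Fin.zero   ≈⟨ xyx⁻¹≈y _ _ ⟩
      x′ (Fin.suc i) ∎
    where
    open ≈-Reasoning
    at-unit : x Fin.zero + x (Fin.suc i) ≈ x′ Fin.zero + x′ (Fin.suc i)
    at-unit = trans (+-congˡ (sym (dot-unitVec (tail x) i)))
                    (trans (eq (unitVec i)) (+-congˡ (dot-unitVec (tail x′) i)))

  -- The codewords of weight b are listed, without repetition, by the coefficient
  -- vectors x ∈ K^(k+1) with weight (encode x) = b; weightCount counts these.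
  numWordsOfWeight : ∀ b → NumWordsOfWeight b
    (ℤ.+ ∑< (suc k) (λ r → gauss q k r ℕ.* prodℕ q Q r ℕ.* wordsOfRank q k Q b r))
  numWordsOfWeight b =
      length codings
    , ≡.cong ℤ.+_ (≡.trans (≡.sym (weightCount b)) (≡.sym (length-filter hasWeight? (tuples elements (suc k)))))
    , (λ i → encode (lookup codings i)) , satisfies , injective , surjective
    where
    hasWeight? : Decidable (λ x → weight (encode x) ≡ b)
    hasWeight? x = weight (encode x) ℕ.≟ b

    codings : List (Vector Carrier (suc k))
    codings = filter hasWeight? (tuples elements (suc k))

    module Codings = Listing (≋-setoid (suc k))

    satisfies : ∀ i → InCode (encode (lookup codings i)) × weight (encode (lookup codings i)) ≡ b
    satisfies i = (lookup codings i , λ u → refl) , All.lookup (Allₚ.all-filter hasWeight? (tuples elements (suc k))) (∈ₚ-lookup i)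

    injective : ∀ i j → encode (lookup codings i) ≋ encode (lookup codings j) → i ≡ j
    injective i j eq = Codings.lookup-injective
      (Uniqueₚ.filter⁺ (≋-setoid (suc k)) hasWeight? (Tuples.tuples-unique elements-unique (suc k)))
      i j (encode-injective eq)

    surjective : ∀ w → InCode w × weight w ≡ b → ∃ λ i → w ≋ encode (lookup codings i)
    surjective w ((x , w≋x) , weight≡b) =
      Any.index x∈codings , λ u → trans (w≋x u) (encode-cong (Anyₚ.lookup-index x∈codings) u)
      where
      x∈codings : x ∈ᵗ codings
      x∈codings = Memberₚ.∈-filter⁺ (≋-setoid (suc k)) hasWeight?
        (λ x≋x′ → ≡.trans (weight-cong (encode-cong (λ i → sym (x≋x′ i)))))
        (Tuples.tuples-complete elements-complete (suc k) x)
        (≡.trans (weight-cong (λ u → sym (w≋x u))) weight≡b)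

open import Data.Nat using (_+_)
open import Data.Integer using (+_)

mainTheorem6 : ∀ {c ℓ c′ ℓ′ : Level} (q s m : ℕ) → IsPrimePower q → 2 ≤ s → 1 ≤ m →
    (F : FiniteField c ℓ q) (K : FiniteField c′ ℓ′ (q ^ m))
    (ι : FiniteField.Carrier F → FiniteField.Carrier K) → IsFieldHom F K ι →
    ∀ a b →
      (a + b ≡ q ^ (s ∸ 1) →
        RM.NumWordsOfWeight F K ι (s ∸ 1) b (coeffXY a b (rmFormula q s (+ (q ^ m)))))
    × (a + b ≢ q ^ (s ∸ 1) → coeffXY a b (rmFormula q s (+ (q ^ m))) ≡ + 0)
mainTheorem6 q (suc k) m _ _ _ F K ι hom a b = countsWords , rmFormula-coeff-otherDegree q k m a b
  where
  open Counting F K ι hom k using (q-nonZero; numWordsOfWeight)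
  countsWords : a + b ≡ q ^ k →
    RM.NumWordsOfWeight F K ι k b (coeffXY a b (rmFormula q (suc k) (+ (q ^ m))))
  countsWords a+b≡n rewrite rmFormula-coeff q k m a b a+b≡n = numWordsOfWeight b
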